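{- Let $D$ be a finite simple digraph and $(T,\beta,\gamma)$ an $\mathrm{SC}^\infty_\emptyset$-directed tree decomposition of $D$ of width $k$, and let $t\in V(T)$ with $|\beta(t)|\ge 2$. Then there exists a $\mathrm{USC}_\emptyset$-directed tree decomposition $(T',\beta',\gamma')$ of $D$ of width at most $k$ such that $V(T')=V(T)\cup\{t'\}$ for a node $t'\notin V(T)$, $|\beta'(r)|=|\beta(r)|$ for all $r\in V(T)-\{t\}$, $|\beta'(t)|=|\beta(t)|-1$, and $|\beta'(t')|=1$.
   Context: An abstract digraph decomposition of $D$ is a triple $(T,\beta,\gamma)$ with $T$ a rooted directed tree (edges directed away from the root), $\beta:V(T)\to 2^{V(D)}$, $\gamma:E(T)\to 2^{V(D)}$, $\bigcup_t\beta(t)=V(D)$. Let $\Gamma(t)=\beta(t)\cup\bigcup_{e\text{ incident with }t}\gamma(e)$, $T_t$ the subtree of nodes reachable from $t$, $\beta(T_t)=\bigcup_{t'\in V(T_t)}\beta(t')$; width $=\max_t|\Gamma(t)|-1$. An $\mathrm{SC}^\infty_\emptyset$-directed tree decomposition is an abstract digraph decomposition such that (1) $\{\beta(t)\}$ is a partition of $V(D)$ into possibly empty sets with nonempty root bag, and (2) for every $e=(s,t)\in E(T)$, $\beta(T_t)$ is the vertex set of a strong component of $D-\gamma(e)$ (no bound on $|V(T)|$). A $\mathrm{USC}_\emptyset$-directed tree decomposition is an abstract digraph decomposition satisfying (1) and, instead of (2): for every $e=(s,t)\in E(T)$, $\beta(T_t)$ is the union of vertex sets of some strong components of $D-\gamma(e)$.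 -}

module Defs where

open import Data.Nat using (ℕ; zero; suc; _≤_; _∸_)
open import Data.Bool using (Bool; true; false; if_then_else_)
open import Data.Fin using (Fin)
open import Data.Fin.Subset using (Subset; _∈_; _∉_; _∪_; ⊥; ⋃; ∣_∣)
open import Data.List using (map)
open import Data.List using () renaming ([] to []ˡ)
open import Data.Vec using (allFin)
open import Data.Vec using (toList)
open import Data.Product using (Σ; _×_; ∃)
open import Relation.Nullary using (¬_)
open import Relation.Binary.PropositionalEquality using (_≡_)

-- Finite simple digraphs on vertex set Fin n:
-- arcs given by a Bool-valued relation (so no parallel arcs), loopless.

record Digraph (n : ℕ) : Set where
  field
    arc      : Fin n → Fin n → Bool
    loopless : ∀ v → arc v v ≡ false
open Digraph public

-- Directed walks in D - X (all vertices, including endpoints, avoid X).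
data ReachAvoid {n : ℕ} (D : Digraph n) (X : Subset n) : Fin n → Fin n → Set where
  here : ∀ {u} → u ∉ X → ReachAvoid D X u u
  step : ∀ {u w v} → u ∉ X → arc D u w ≡ true → ReachAvoid D X w v → ReachAvoid D X u v

record IsStrongComponent {n : ℕ} (D : Digraph n) (X : Subset n) (P : Fin n → Set) : Set where
  field
    nonempty : ∃ λ v → P v
    avoids   : ∀ v → P v → v ∉ X
    strong   : ∀ u v → P u → P v → ReachAvoid D X u v
    maximal  : ∀ u w → P u → w ∉ X → ReachAvoid D X u w → ReachAvoid D X w u → P w

-- Rooted directed trees on node set Fin m, edges directed away from the root.

data TReach {m : ℕ} (E : Fin m → Fin m → Bool) : Fin m → Fin m → Set where
  here : ∀ {s} → TReach E s s
  step : ∀ {s r t} → E s r ≡ true → TReach E r t → TReach E s t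

record RootedTree (m : ℕ) : Set where
  field
    edge           : Fin m → Fin m → Bool
    root           : Fin m
    root-no-parent : ∀ s → edge s root ≡ false
    parent-unique  : ∀ s s' t → edge s t ≡ true → edge s' t ≡ true → s ≡ s'
    all-reachable  : ∀ t → TReach edge root t
open RootedTree public

-- Abstract digraph decompositions (T, β, γ) of D with |V(T)| = m.
-- γ s t is only meaningful when (s,t) is an edge of T.

record Decomp {n : ℕ} (D : Digraph n) (m : ℕ) : Set where
  field
    tree : RootedTree m
    β    : Fin m → Subset n
    γ    : Fin m → Fin m → Subset n
open Decomp public

module _ {n m : ℕ} {D : Digraph n} (𝒟 : Decomp D m) where

  private
    E = edge (tree 𝒟)

  -- Γ(t) = β(t) ∪ ⋃ { γ(e) : e an edge of T incident with t }
  Γ : Fin m → Subset n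
  Γ t = β 𝒟 t ∪ ⋃ (map (λ s → (if E s t then γ 𝒟 s t else ⊥) ∪ (if E t s then γ 𝒟 t s else ⊥))
                        (toList (allFin m)))

  -- width = max_t |Γ(t)| - 1
  WidthAtMost : ℕ → Set
  WidthAtMost k = ∀ t → ∣ Γ t ∣ ≤ suc k

  HasWidth : ℕ → Set
  HasWidth k = WidthAtMost k × ∃ λ t → ∣ Γ t ∣ ≡ suc k

  InSubtree : Fin m → Fin n → Set
  InSubtree t v = ∃ λ t' → TReach E t t' × v ∈ β 𝒟 t'

  IsPartition : Set
  IsPartition = (∀ v → ∃ λ t → v ∈ β 𝒟 t)
              × (∀ v t t' → v ∈ β 𝒟 t → v ∈ β 𝒟 t' → t ≡ t')
              × (∃ λ v → v ∈ β 𝒟 (root (tree 𝒟)))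

  IsSCDTD : Set
  IsSCDTD = IsPartition
          × (∀ s t → E s t ≡ true → IsStrongComponent D (γ 𝒟 s t) (InSubtree t))

  -- USC_∅-directed tree decomposition: β(T_t) is the union of the vertex sets of
  -- some strong components of D - γ(e), i.e. every vertex of β(T_t) lies in a strong
  -- component of D - γ(e) contained in β(T_t).
  IsUSCDTD : Set
  IsUSCDTD = IsPartition
           × (∀ s t → E s t ≡ true →
                ∀ v → InSubtree t v →
                  Σ (Subset n) λ C → IsStrongComponent D (γ 𝒟 s t) (λ w → w ∈ C)
                                   × v ∈ C × (∀ w → w ∈ C → InSubtree t w))

-- Pick v ∈ β(t) and detach it into a new node t′ inserted between t and its parent
-- (t′ becomes the root if t was): β′(t′) = {v}, β′(t) = β(t) − v, the edge into t′
-- keeps the old adhesion γ(p,t), and the edge t′ → t gets γ(p,t) ∪ {v}.  Every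
-- subtree other than that of t keeps its vertex set, so those edges stay strong
-- components.  The subtree of t loses exactly v, and removing v ∉ γ(p,t) from a
-- strong component of D − γ(p,t) leaves a union of strong components of
-- D − (γ(p,t) ∪ {v}).  Every new adhesion lies in the old Γ(t) or Γ of an old
-- neighbour, so the width does not grow.
module Submission where

open import Defs
open import Data.Nat using (ℕ; suc; _≤_; _∸_)
open import Data.Fin using (Fin; inject₁; fromℕ)
open import Data.Fin.Subset using (∣_∣)
open import Data.Product using (Σ; _×_)
open import Relation.Binary.PropositionalEquality using (_≡_; _≢_)

open import Data.Bool using (Bool; true; false; if_then_else_)
open import Data.Bool.Properties using () renaming (_≟_ to _≟ᵇ_)
open import Data.Empty using (⊥-elim)
open import Data.Fin using (zero; suc)
open import Data.Fin.Properties using (any?; _≟_)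
open import Data.Fin.Relation.Unary.Top using (view; ‵fromℕ; ‵inject₁; view-inject₁; view-fromℕ)
open import Data.Fin.Subset
  using (Subset; _∈_; _∉_; _⊆_; _⊃_; _∪_; _-_; ⁅_⁆; ⊥; ⋃; Nonempty; inside; outside)
open import Data.Fin.Subset.Properties
  using (_∈?_; ⊆-refl; ⊥⊆; ∉⊥; p⊆p∪q; x∈p∪q⁻; x∈p∪q⁺; x∈⁅x⁆; x∈⁅y⁆⇒x≡y; ∣⁅x⁆∣≡1; ∣⊥∣≡0;
         p─q⊆p; x∈p∧x≢y⇒x∈p-y; p─⊥≡p; p⊆q⇒∣p∣≤∣q∣; nonempty?; Empty-unique)
open import Data.Fin.Subset.Induction using (⊃-wellFounded)
open import Data.List using (List; map) renaming ([] to []ˡ; _∷_ to _∷ˡ_)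
open import Data.List.Membership.Propositional using () renaming (_∈_ to _∈ˡ_)
open import Data.List.Relation.Unary.Any using () renaming (here to hereˡ; there to thereˡ)
open import Data.Maybe using (Maybe; just; nothing)
open import Data.Nat using (_<_; s≤s; z≤n)
open import Data.Nat.Properties using (≤-trans; <-irrefl)
open import Data.Product using (∃; _,_; proj₁; proj₂)
open import Data.Sum using (_⊎_; inj₁; inj₂)
open import Data.Vec using (_∷_; here; there; toList; allFin; tabulate)
open import Data.Vec.Properties using (lookup⇒[]=; []=⇒lookup; lookup∘tabulate)
open import Data.Vec.Membership.Propositional.Properties using (∈-toList⁺; ∈-allFin⁺)
open import Function using (_∘_)
open import Induction.WellFounded using (Acc; acc)
open import Relation.Binary.Construct.Closure.ReflexiveTransitive using (Star; ε; _◅_)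
open import Relation.Binary.PropositionalEquality using (refl; sym; trans; cong; subst; subst₂)
open import Relation.Nullary using (¬_; Dec; yes; no; does; proof; contradiction)
open import Relation.Nullary.Reflects using (Reflects; invert)
open import Relation.Nullary.Decidable using (_×-dec_; dec-true; dec-false; map′)
import Relation.Unary as U

module _ {k : ℕ} {P : Fin k → Set} (P? : ∀ x → Dec (P x)) where

  toSubset : Subset k
  toSubset = tabulate (does ∘ P?)

  ∈-toSubset⁺ : ∀ {x} → P x → x ∈ toSubset
  ∈-toSubset⁺ {x} px =
    lookup⇒[]= x toSubset (trans (lookup∘tabulate (does ∘ P?) x) (dec-true (P? x) px))

  ∈-toSubset⁻ : ∀ {x} → x ∈ toSubset → P x
  ∈-toSubset⁻ {x} x∈ = invert (subst (Reflects (P x)) does≡true (proof (P? x)))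
    where does≡true = trans (sym (lookup∘tabulate (does ∘ P?) x)) ([]=⇒lookup x∈)

x∉p∧x≢y⇒x∉p∪⁅y⁆ : ∀ {n} {p : Subset n} {x y} → x ∉ p → x ≢ y → x ∉ p ∪ ⁅ y ⁆
x∉p∧x≢y⇒x∉p∪⁅y⁆ {p = p} {y = y} x∉p x≢y x∈ with x∈p∪q⁻ p ⁅ y ⁆ x∈
... | inj₁ x∈p = x∉p x∈p
... | inj₂ x∈y = x≢y (x∈⁅y⁆⇒x≡y y x∈y)

x∉p-x : ∀ {n} (p : Subset n) x → x ∉ p - x
x∉p-x (_ ∷ p) zero    ()
x∉p-x (_ ∷ p) (suc x) (there x∈) = x∉p-x p x x∈

x∉p⇒p-x≡p : ∀ {n} {p : Subset n} {x} → x ∉ p → p - x ≡ p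
x∉p⇒p-x≡p {p = s ∷ p} {zero}  x∉p with s
... | inside  = ⊥-elim (x∉p here)
... | outside = cong (outside ∷_) (p─⊥≡p p)
x∉p⇒p-x≡p {p = s ∷ p} {suc x} x∉p = cong (s ∷_) (x∉p⇒p-x≡p (x∉p ∘ there))

x∈p⇒suc∣p-x∣≡∣p∣ : ∀ {n} {p : Subset n} {x} → x ∈ p → suc ∣ p - x ∣ ≡ ∣ p ∣
x∈p⇒suc∣p-x∣≡∣p∣ {p = inside ∷ p}  {zero}  here       = cong (suc ∘ ∣_∣) (p─⊥≡p p)
x∈p⇒suc∣p-x∣≡∣p∣ {p = inside ∷ p}  {suc x} (there x∈) = cong suc (x∈p⇒suc∣p-x∣≡∣p∣ x∈)
x∈p⇒suc∣p-x∣≡∣p∣ {p = outside ∷ p} {suc x} (there x∈) = x∈p⇒suc∣p-x∣≡∣p∣ x∈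

0<∣p∣⇒Nonempty : ∀ {n} {p : Subset n} → 0 < ∣ p ∣ → Nonempty p
0<∣p∣⇒Nonempty {n} {p} 0<∣p∣ with nonempty? p
... | yes ne = ne
... | no ¬ne = contradiction (subst (0 <_) ∣p∣≡0 0<∣p∣) (<-irrefl refl)
  where ∣p∣≡0 = trans (cong ∣_∣ (Empty-unique ¬ne)) (∣⊥∣≡0 n)

∈⋃⁻ : ∀ {n} {A : Set} (f : A → Subset n) (as : List A) {x} → x ∈ ⋃ (map f as) → ∃ λ a → x ∈ f a
∈⋃⁻ f []ˡ       x∈ = ⊥-elim (∉⊥ x∈)
∈⋃⁻ f (a ∷ˡ as) x∈ with x∈p∪q⁻ (f a) (⋃ (map f as)) x∈
... | inj₁ x∈fa = a , x∈fa
... | inj₂ x∈⋃ = ∈⋃⁻ f as x∈⋃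

∈⋃⁺ : ∀ {n} {A : Set} (f : A → Subset n) {as : List A} {a x} → a ∈ˡ as → x ∈ f a → x ∈ ⋃ (map f as)
∈⋃⁺ f (hereˡ refl) x∈ = x∈p∪q⁺ (inj₁ x∈)
∈⋃⁺ f (thereˡ a∈)  x∈ = x∈p∪q⁺ (inj₂ (∈⋃⁺ f a∈ x∈))

∈⋃-allFin⁺ : ∀ {n m} (f : Fin m → Subset n) a {x} → x ∈ f a → x ∈ ⋃ (map f (toList (allFin m)))
∈⋃-allFin⁺ f a = ∈⋃⁺ f (∈-toList⁺ (∈-allFin⁺ a))

∈-if⁻ : ∀ {n} b {p : Subset n} {x} → x ∈ (if b then p else ⊥) → b ≡ true × x ∈ p
∈-if⁻ true  x∈ = refl , x∈
∈-if⁻ false x∈ = ⊥-elim (∉⊥ x∈)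

∈-if⁺ : ∀ {n b} {p : Subset n} {x} → b ≡ true → x ∈ p → x ∈ (if b then p else ⊥)
∈-if⁺ refl x∈ = x∈

module _ {n : ℕ} {D : Digraph n} where

  ReachAvoid-start∉ : ∀ {X u v} → ReachAvoid D X u v → u ∉ X
  ReachAvoid-start∉ (here u∉X)     = u∉X
  ReachAvoid-start∉ (step u∉X _ _) = u∉X

  ReachAvoid-trans : ∀ {X u w v} → ReachAvoid D X u w → ReachAvoid D X w v → ReachAvoid D X u v
  ReachAvoid-trans (here _)       r′ = r′
  ReachAvoid-trans (step u∉X a r) r′ = step u∉X a (ReachAvoid-trans r r′)

  ReachAvoid-antimono : ∀ {X Y u v} → X ⊆ Y → ReachAvoid D Y u v → ReachAvoid D X u v
  ReachAvoid-antimono X⊆Y (here u∉Y)     = here (u∉Y ∘ X⊆Y)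
  ReachAvoid-antimono X⊆Y (step u∉Y a r) = step (u∉Y ∘ X⊆Y) a (ReachAvoid-antimono X⊆Y r)

  -- Cut the walk after its last visit of u.
  ReachAvoid-lastExit : ∀ {X u w v} → u ≢ v → ReachAvoid D X w v →
    ReachAvoid D (X ∪ ⁅ u ⁆) w v ⊎ ∃ λ u′ → arc D u u′ ≡ true × ReachAvoid D (X ∪ ⁅ u ⁆) u′ v
  ReachAvoid-lastExit {u = u} {w} u≢v (here w∉X) with w ≟ u
  ... | yes refl = ⊥-elim (u≢v refl)
  ... | no w≢u   = inj₁ (here (x∉p∧x≢y⇒x∉p∪⁅y⁆ w∉X w≢u))
  ReachAvoid-lastExit {u = u} {w} u≢v (step w∉X a r) with ReachAvoid-lastExit u≢v r
  ... | inj₂ exit = inj₂ exit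
  ... | inj₁ r′ with w ≟ u
  ...   | yes refl = inj₂ (_ , a , r′)
  ...   | no w≢u   = inj₁ (step (x∉p∧x≢y⇒x∉p∪⁅y⁆ w∉X w≢u) a r′)

-- Recursion on the avoided set, which grows strictly at each step.
reachAvoid? : ∀ {n} (D : Digraph n) X u v → Dec (ReachAvoid D X u v)
reachAvoid? D X = go (⊃-wellFounded X)
  where
  go : ∀ {X} → Acc _⊃_ X → ∀ u v → Dec (ReachAvoid D X u v)
  go {X} (acc rec) u v with u ∈? X | u ≟ v
  ... | yes u∈X | _        = no λ r → ReachAvoid-start∉ r u∈X
  ... | no u∉X  | yes refl = yes (here u∉X)
  ... | no u∉X  | no u≢v   =
    map′ (λ (u′ , a , r) → step u∉X a (ReachAvoid-antimono (p⊆p∪q ⁅ u ⁆) r)) leave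
         (any? λ u′ → (arc D u u′ ≟ᵇ true) ×-dec go (rec X⊂X∪⁅u⁆) u′ v)
    where
    u∈X∪⁅u⁆ : u ∈ X ∪ ⁅ u ⁆
    u∈X∪⁅u⁆ = x∈p∪q⁺ (inj₂ (x∈⁅x⁆ u))

    X⊂X∪⁅u⁆ : (X ∪ ⁅ u ⁆) ⊃ X
    X⊂X∪⁅u⁆ = p⊆p∪q ⁅ u ⁆ , u , u∈X∪⁅u⁆ , u∉X

    leave : ReachAvoid D X u v → ∃ λ u′ → arc D u u′ ≡ true × ReachAvoid D (X ∪ ⁅ u ⁆) u′ v
    leave r with ReachAvoid-lastExit u≢v r
    ... | inj₁ r′   = ⊥-elim (ReachAvoid-start∉ r′ u∈X∪⁅u⁆)
    ... | inj₂ exit = exit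

UnionOfStrongComponents : ∀ {n} → Digraph n → Subset n → (Fin n → Set) → Set
UnionOfStrongComponents {n} D X P = ∀ u → P u →
  Σ (Subset n) λ C → IsStrongComponent D X (_∈ C) × u ∈ C × (∀ w → w ∈ C → P w)

mutuallyReachable? : ∀ {n} (D : Digraph n) X u w → Dec (ReachAvoid D X u w × ReachAvoid D X w u)
mutuallyReachable? D X u w = reachAvoid? D X u w ×-dec reachAvoid? D X w u

component : ∀ {n} → Digraph n → Subset n → Fin n → Subset n
component D X u = toSubset (mutuallyReachable? D X u)

module _ {n : ℕ} {D : Digraph n} where

  ∈-component⁺ : ∀ {X u w} → ReachAvoid D X u w → ReachAvoid D X w u → w ∈ component D X u
  ∈-component⁺ {X} {u} r r′ = ∈-toSubset⁺ (mutuallyReachable? D X u) (r , r′)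

  ∈-component⁻ : ∀ {X u w} → w ∈ component D X u → ReachAvoid D X u w × ReachAvoid D X w u
  ∈-component⁻ {X} {u} = ∈-toSubset⁻ (mutuallyReachable? D X u)

  u∈component : ∀ {X u} → u ∉ X → u ∈ component D X u
  u∈component u∉X = ∈-component⁺ (here u∉X) (here u∉X)

  component∉ : ∀ {X u w} → w ∈ component D X u → w ∉ X
  component∉ = ReachAvoid-start∉ ∘ proj₂ ∘ ∈-component⁻

  component-isStrongComponent : ∀ {X u} → u ∉ X → IsStrongComponent D X (_∈ component D X u)
  component-isStrongComponent u∉X = record
    { nonempty = _ , u∈component u∉X
    ; avoids   = λ _ → component∉
    ; strong   = λ _ _ w∈ w′∈ →
        ReachAvoid-trans (proj₂ (∈-component⁻ w∈)) (proj₁ (∈-component⁻ w′∈))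
    ; maximal  = λ _ _ w∈ _ r r′ →
        ∈-component⁺ (ReachAvoid-trans (proj₁ (∈-component⁻ w∈)) r)
                     (ReachAvoid-trans r′ (proj₂ (∈-component⁻ w∈)))
    }

  component⊆strongComponent : ∀ {X Y P u} → IsStrongComponent D X P → P u → X ⊆ Y →
                              ∀ w → w ∈ component D Y u → P w
  component⊆strongComponent sc pu X⊆Y w w∈ =
    IsStrongComponent.maximal sc _ w pu (component∉ w∈ ∘ X⊆Y)
      (ReachAvoid-antimono X⊆Y (proj₁ (∈-component⁻ w∈)))
      (ReachAvoid-antimono X⊆Y (proj₂ (∈-component⁻ w∈)))

  IsStrongComponent⇒UnionOfStrongComponents : ∀ {X P} →
    IsStrongComponent D X P → UnionOfStrongComponents D X P
  IsStrongComponent⇒UnionOfStrongComponents sc u pu =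
    component D _ u , component-isStrongComponent u∉X , u∈component u∉X ,
    component⊆strongComponent sc pu ⊆-refl
    where u∉X = IsStrongComponent.avoids sc u pu

  UnionOfStrongComponents-vertices : ∀ {X} → UnionOfStrongComponents D X (_∉ X)
  UnionOfStrongComponents-vertices u u∉X =
    component D _ u , component-isStrongComponent u∉X , u∈component u∉X , λ _ → component∉

  UnionOfStrongComponents-remove : ∀ {X Y P} → UnionOfStrongComponents D X P → X ⊆ Y →
    UnionOfStrongComponents D Y (λ w → P w × w ∉ Y)
  UnionOfStrongComponents-remove ∪P X⊆Y u (pu , u∉Y) =
    let (C , sc , u∈C , C⊆P) = ∪P u pu in
    component D _ u , component-isStrongComponent u∉Y , u∈component u∉Y ,
    λ w w∈ → C⊆P w (component⊆strongComponent sc u∈C X⊆Y w w∈) , component∉ w∈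

  UnionOfStrongComponents-resp : ∀ {X P Q} → P U.≐ Q →
    UnionOfStrongComponents D X P → UnionOfStrongComponents D X Q
  UnionOfStrongComponents-resp (P⊆Q , Q⊆P) ∪P u qu =
    let (C , sc , u∈C , C⊆P) = ∪P u (Q⊆P qu) in C , sc , u∈C , λ w w∈ → P⊆Q (C⊆P w w∈)

module _ {n m : ℕ} {D : Digraph n} (𝒟 : Decomp D m) where
  private
    E = edge (tree 𝒟)

  β⊆Γ : ∀ {u} → β 𝒟 u ⊆ Γ 𝒟 u
  β⊆Γ x∈ = x∈p∪q⁺ (inj₁ x∈)

  γ-in⊆Γ : ∀ {s u} → E s u ≡ true → γ 𝒟 s u ⊆ Γ 𝒟 u
  γ-in⊆Γ {s} e x∈ = x∈p∪q⁺ (inj₂ (∈⋃-allFin⁺ _ s (x∈p∪q⁺ (inj₁ (∈-if⁺ e x∈)))))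

  γ-out⊆Γ : ∀ {u s} → E u s ≡ true → γ 𝒟 u s ⊆ Γ 𝒟 u
  γ-out⊆Γ {s = s} e x∈ = x∈p∪q⁺ (inj₂ (∈⋃-allFin⁺ _ s (x∈p∪q⁺ (inj₂ (∈-if⁺ e x∈)))))

  Γ-least : ∀ {u Y} → β 𝒟 u ⊆ Y → (∀ s → E s u ≡ true → γ 𝒟 s u ⊆ Y) →
            (∀ s → E u s ≡ true → γ 𝒟 u s ⊆ Y) → Γ 𝒟 u ⊆ Y
  Γ-least {u} β⊆Y in⊆Y out⊆Y x∈ with x∈p∪q⁻ (β 𝒟 u) _ x∈
  ... | inj₁ x∈β = β⊆Y x∈β
  ... | inj₂ x∈⋃ with ∈⋃⁻ _ (toList (allFin m)) x∈⋃
  ...   | s , x∈in∪out with x∈p∪q⁻ (if E s u then γ 𝒟 s u else ⊥) _ x∈in∪out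
  ...     | inj₁ x∈in  = let (e , x∈γ) = ∈-if⁻ (E s u) x∈in  in in⊆Y s e x∈γ
  ...     | inj₂ x∈out = let (e , x∈γ) = ∈-if⁻ (E u s) x∈out in out⊆Y s e x∈γ

  InSubtree-root : IsPartition 𝒟 → ∀ x → InSubtree 𝒟 (root (tree 𝒟)) x
  InSubtree-root (covers , _) x = let (u , x∈) = covers x in u , all-reachable (tree 𝒟) u , x∈

module _ {m : ℕ} (T : RootedTree m) where
  private
    E = edge T

  OnCycle : Fin m → Set
  OnCycle x = ∃ λ y → TReach E x y × E y x ≡ true

  step-lastEdge : ∀ {x w y} → E x w ≡ true → TReach E w y → ∃ λ z → TReach E x z × E z y ≡ true
  step-lastEdge e here        = _ , here , e
  step-lastEdge e (step e′ p) = let (z , q , ez) = step-lastEdge e′ p in z , step e q , ez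

  OnCycle-parent : ∀ {s x} → E s x ≡ true → OnCycle x → OnCycle s
  OnCycle-parent {s} {x} esx (y , x→y , eyx) with parent-unique T y s x eyx esx
  ... | refl = step-lastEdge esx x→y

  OnCycle-ancestor : ∀ {s x} → TReach E s x → OnCycle x → OnCycle s
  OnCycle-ancestor here       c = c
  OnCycle-ancestor (step e p) c = OnCycle-parent e (OnCycle-ancestor p c)

  ¬OnCycle : ∀ x → ¬ OnCycle x
  ¬OnCycle x c with OnCycle-ancestor (all-reachable T x) c
  ... | y , _ , e with trans (sym (root-no-parent T y)) e
  ...   | ()

  hasParent⊎root : ∀ x → (∃ λ p → E p x ≡ true) ⊎ root T ≡ x
  hasParent⊎root x with all-reachable T x
  ... | here     = inj₂ refl
  ... | step e p = let (z , _ , ez) = step-lastEdge e p in inj₁ (z , ez)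

-- Fin (suc m) as Maybe (Fin m), with fromℕ m for nothing

toMaybe : ∀ {m} → Fin (suc m) → Maybe (Fin m)
toMaybe i with view i
... | ‵fromℕ     = nothing
... | ‵inject₁ j = just j

fromMaybe : ∀ {m} → Maybe (Fin m) → Fin (suc m)
fromMaybe (just a) = inject₁ a
fromMaybe nothing  = fromℕ _

toMaybe-inject₁ : ∀ {m} (a : Fin m) → toMaybe (inject₁ a) ≡ just a
toMaybe-inject₁ a rewrite view-inject₁ a = refl

toMaybe-fromℕ : ∀ m → toMaybe (fromℕ m) ≡ nothing
toMaybe-fromℕ m rewrite view-fromℕ m = refl

toMaybe-fromMaybe : ∀ {m} (z : Maybe (Fin m)) → toMaybe (fromMaybe z) ≡ z
toMaybe-fromMaybe (just a) = toMaybe-inject₁ a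
toMaybe-fromMaybe nothing  = toMaybe-fromℕ _

fromMaybe-toMaybe : ∀ {m} (i : Fin (suc m)) → fromMaybe (toMaybe i) ≡ i
fromMaybe-toMaybe i with view i
... | ‵fromℕ     = refl
... | ‵inject₁ j = refl

toMaybe-injective : ∀ {m} {i j : Fin (suc m)} → toMaybe i ≡ toMaybe j → i ≡ j
toMaybe-injective {i = i} {j} eq =
  trans (sym (fromMaybe-toMaybe i)) (trans (cong fromMaybe eq) (fromMaybe-toMaybe j))

-- Detaching v from the bag of t

module Detach {n m : ℕ} {D : Digraph n} (𝒟 : Decomp D m) (isSC : IsSCDTD 𝒟)
              (t : Fin m) (v : Fin n) (v∈βt : v ∈ β 𝒟 t) where

  private
    T = tree 𝒟
    E = edge T
    ρ = root T

    partition = proj₁ isSC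

    bag-unique : ∀ x a b → x ∈ β 𝒟 a → x ∈ β 𝒟 b → a ≡ b
    bag-unique = proj₁ (proj₂ partition)

    adhesion-sc : ∀ a b → E a b ≡ true → IsStrongComponent D (γ 𝒟 a b) (InSubtree 𝒟 b)
    adhesion-sc = proj₂ isSC

  -- nothing is the new node t′
  Node : Set
  Node = Maybe (Fin m)

  origin : Node → Fin m
  origin (just a) = a
  origin nothing  = t

  edge′ : Node → Node → Bool
  edge′ (just a) (just b) = if does (b ≟ t) then false else E a b
  edge′ (just a) nothing  = E a t
  edge′ nothing  (just b) = does (b ≟ t)
  edge′ nothing  nothing  = false

  root′ : Node
  root′ with t ≟ ρ
  ... | yes _ = nothing
  ... | no _  = just ρ

  γ-parent : Subset n
  γ-parent = ⋃ (map (λ a → if E a t then γ 𝒟 a t else ⊥) (toList (allFin m)))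

  β′ : Node → Subset n
  β′ (just b) = β 𝒟 b - v
  β′ nothing  = ⁅ v ⁆

  γ′ : Node → Node → Subset n
  γ′ (just a) (just b) = γ 𝒟 a b
  γ′ (just a) nothing  = γ 𝒟 a t
  γ′ nothing  _        = γ-parent ∪ ⁅ v ⁆

  Edge′ : Node → Node → Set
  Edge′ z w = edge′ z w ≡ true

  Reach′ : Node → Node → Set
  Reach′ = Star Edge′

  InSubtree′ : Node → Fin n → Set
  InSubtree′ z x = ∃ λ w → Reach′ z w × x ∈ β′ w

  edge′-old⁺ : ∀ {a b} → b ≢ t → E a b ≡ true → Edge′ (just a) (just b)
  edge′-old⁺ {b = b} b≢t e rewrite dec-false (b ≟ t) b≢t = e

  edge′-old⁻ : ∀ {a b} → Edge′ (just a) (just b) → b ≢ t × E a b ≡ true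
  edge′-old⁻ {b = b} e with b ≟ t
  edge′-old⁻ () | yes _
  ... | no b≢t = b≢t , e

  edge′-new⁺ : Edge′ nothing (just t)
  edge′-new⁺ = dec-true (t ≟ t) refl

  edge′-new⁻ : ∀ {b} → Edge′ nothing (just b) → b ≡ t
  edge′-new⁻ {b} e with b ≟ t
  ... | yes b≡t = b≡t
  edge′-new⁻ () | no _

  Reach′⇒TReach : ∀ {z w} → Reach′ z w → TReach E (origin z) (origin w)
  Reach′⇒TReach ε                             = here
  Reach′⇒TReach (_◅_ {just _}  {just _}  e p) = step (proj₂ (edge′-old⁻ e)) (Reach′⇒TReach p)
  Reach′⇒TReach (_◅_ {just _}  {nothing} e p) = step e (Reach′⇒TReach p)
  Reach′⇒TReach (_◅_ {nothing} {just b}  e p) with edge′-new⁻ {b} e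
  ... | refl = Reach′⇒TReach p
  Reach′⇒TReach (_◅_ {nothing} {nothing} () _)

  TReach⇒Reach′ : ∀ {a b} → TReach E a b → Reach′ (just a) (just b)
  TReach⇒Reach′ here = ε
  TReach⇒Reach′ (step {r = r} e p) with r ≟ t
  ... | yes refl = _◅_ {j = nothing} e (edge′-new⁺ ◅ TReach⇒Reach′ p)
  ... | no r≢t   = edge′-old⁺ r≢t e ◅ TReach⇒Reach′ p

  TReach⇒Reach′-new : ∀ {a} → a ≢ t → TReach E a t → Reach′ (just a) nothing
  TReach⇒Reach′-new a≢t here = ⊥-elim (a≢t refl)
  TReach⇒Reach′-new _ (step {r = r} e p) with r ≟ t
  ... | yes refl = e ◅ ε
  ... | no r≢t   = edge′-old⁺ r≢t e ◅ TReach⇒Reach′-new r≢t p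

  Reach′-new⇒parent : ∀ {a} → Reach′ (just a) nothing → ∃ λ p → TReach E a p × E p t ≡ true
  Reach′-new⇒parent (_◅_ {j = nothing} e _) = _ , here , e
  Reach′-new⇒parent (_◅_ {j = just _}  e p) =
    let (q , a→q , eq) = Reach′-new⇒parent p in q , step (proj₂ (edge′-old⁻ e)) a→q , eq

  β′⊆β : ∀ w → β′ w ⊆ β 𝒟 (origin w)
  β′⊆β (just b) = p─q⊆p (β 𝒟 b) ⁅ v ⁆
  β′⊆β nothing {x} x∈ = subst (_∈ β 𝒟 t) (sym (x∈⁅y⁆⇒x≡y v x∈)) v∈βt

  v∈β′⇒new : ∀ w → v ∈ β′ w → w ≡ nothing
  v∈β′⇒new (just b) v∈ = ⊥-elim (x∉p-x (β 𝒟 b) v v∈)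
  v∈β′⇒new nothing  _  = refl

  InSubtree′⇒InSubtree : ∀ {z x} → InSubtree′ z x → InSubtree 𝒟 (origin z) x
  InSubtree′⇒InSubtree (w , p , x∈) = origin w , Reach′⇒TReach p , β′⊆β w x∈

  InSubtree⇒InSubtree′ : ∀ {b x} → InSubtree 𝒟 b x → x ≢ v → InSubtree′ (just b) x
  InSubtree⇒InSubtree′ (y , p , x∈) x≢v = just y , TReach⇒Reach′ p , x∈p∧x≢y⇒x∈p-y x∈ x≢v

  -- t′ is not below t, since T has no cycles.
  v∉InSubtree′-t : ¬ InSubtree′ (just t) v
  v∉InSubtree′-t (w , p , v∈) with v∈β′⇒new w v∈
  ... | refl = ¬OnCycle T t (Reach′-new⇒parent p)

  InSubtree′-old : ∀ {b} → b ≢ t → InSubtree 𝒟 b U.≐ InSubtree′ (just b)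
  InSubtree′-old {b} b≢t = old⊆ , InSubtree′⇒InSubtree
    where
    old⊆ : InSubtree 𝒟 b U.⊆ InSubtree′ (just b)
    old⊆ {x} x∈ with x ≟ v
    ... | no x≢v   = InSubtree⇒InSubtree′ x∈ x≢v
    ... | yes refl =
      let (y , b→y , v∈βy) = x∈ in
      nothing , TReach⇒Reach′-new b≢t (subst (TReach E b) (bag-unique v y t v∈βy v∈βt) b→y) ,
      x∈⁅x⁆ v

  InSubtree′-new : InSubtree 𝒟 t U.≐ InSubtree′ nothing
  InSubtree′-new = new⊆ , InSubtree′⇒InSubtree
    where
    new⊆ : InSubtree 𝒟 t U.⊆ InSubtree′ nothing
    new⊆ {x} x∈ with x ≟ v
    ... | yes refl = nothing , ε , x∈⁅x⁆ v
    ... | no x≢v   = let (w , p , x∈β′) = InSubtree⇒InSubtree′ x∈ x≢v in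
                     w , edge′-new⁺ ◅ p , x∈β′

  InSubtree′-t : (λ x → InSubtree 𝒟 t x × x ≢ v) U.≐ InSubtree′ (just t)
  InSubtree′-t = (λ (x∈ , x≢v) → InSubtree⇒InSubtree′ x∈ x≢v)
               , (λ x∈ → InSubtree′⇒InSubtree x∈ , λ { refl → v∉InSubtree′-t x∈ })

  γ-parent⁻ : ∀ {x} → x ∈ γ-parent → ∃ λ a → E a t ≡ true × x ∈ γ 𝒟 a t
  γ-parent⁻ x∈ = let (a , x∈if) = ∈⋃⁻ _ (toList (allFin m)) x∈ in a , ∈-if⁻ (E a t) x∈if

  γ-parent⁺ : ∀ {a} → E a t ≡ true → γ 𝒟 a t ⊆ γ-parent
  γ-parent⁺ {a} e x∈ = ∈⋃-allFin⁺ _ a (∈-if⁺ e x∈)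

  InSubtree-t-avoids-γ-parent : ∀ {x} → InSubtree 𝒟 t x → x ∉ γ-parent
  InSubtree-t-avoids-γ-parent x∈ x∈γ =
    let (a , e , x∈γat) = γ-parent⁻ x∈γ in IsStrongComponent.avoids (adhesion-sc a t e) _ x∈ x∈γat

  -- When t is the root, β(T_t) is all of V(D), which need not be strongly connected.
  InSubtree-t-union : ∃ λ X → X ⊆ γ-parent × UnionOfStrongComponents D X (InSubtree 𝒟 t)
  InSubtree-t-union with hasParent⊎root T t
  ... | inj₁ (a , e) =
    γ 𝒟 a t , γ-parent⁺ e , IsStrongComponent⇒UnionOfStrongComponents (adhesion-sc a t e)
  ... | inj₂ ρ≡t =
    ⊥ , ⊥⊆ , UnionOfStrongComponents-resp
               ((λ {x} _ → subst (λ u → InSubtree 𝒟 u x) ρ≡t (InSubtree-root 𝒟 partition x)) ,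
                (λ _ → ∉⊥))
               UnionOfStrongComponents-vertices

  InSubtree′-t-union : UnionOfStrongComponents D (γ-parent ∪ ⁅ v ⁆) (InSubtree′ (just t))
  InSubtree′-t-union =
    let (X , X⊆γ-parent , ∪t) = InSubtree-t-union in
    UnionOfStrongComponents-resp (to , from)
      (UnionOfStrongComponents-remove ∪t (p⊆p∪q ⁅ v ⁆ ∘ X⊆γ-parent))
    where
    to : (λ x → InSubtree 𝒟 t x × x ∉ γ-parent ∪ ⁅ v ⁆) U.⊆ InSubtree′ (just t)
    to (x∈ , x∉) = proj₁ InSubtree′-t (x∈ , λ { refl → x∉ (x∈p∪q⁺ (inj₂ (x∈⁅x⁆ v))) })
    from : InSubtree′ (just t) U.⊆ (λ x → InSubtree 𝒟 t x × x ∉ γ-parent ∪ ⁅ v ⁆)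
    from x∈′ = let (x∈ , x≢v) = proj₂ InSubtree′-t x∈′ in
               x∈ , x∉p∧x≢y⇒x∉p∪⁅y⁆ (InSubtree-t-avoids-γ-parent x∈) x≢v

  Edge′-union : ∀ z w → Edge′ z w → UnionOfStrongComponents D (γ′ z w) (InSubtree′ w)
  Edge′-union (just a) (just b) e =
    let (b≢t , eab) = edge′-old⁻ e in
    UnionOfStrongComponents-resp (InSubtree′-old b≢t)
      (IsStrongComponent⇒UnionOfStrongComponents (adhesion-sc a b eab))
  Edge′-union (just a) nothing e =
    UnionOfStrongComponents-resp InSubtree′-new
      (IsStrongComponent⇒UnionOfStrongComponents (adhesion-sc a t e))
  Edge′-union nothing (just b) e with edge′-new⁻ {b} e
  ... | refl = InSubtree′-t-union
  Edge′-union nothing nothing ()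

  γ′⊆Γ : ∀ {z w} → Edge′ z w → ∀ {x} → x ∈ γ′ z w → x ∈ Γ 𝒟 (origin z) × x ∈ Γ 𝒟 (origin w)
  γ′⊆Γ {just a} {just b} e x∈ = let eab = proj₂ (edge′-old⁻ e) in γ-out⊆Γ 𝒟 eab x∈ , γ-in⊆Γ 𝒟 eab x∈
  γ′⊆Γ {just a} {nothing} e x∈ = γ-out⊆Γ 𝒟 e x∈ , γ-in⊆Γ 𝒟 e x∈
  γ′⊆Γ {nothing} {just b} e x∈ with edge′-new⁻ {b} e
  ... | refl = Γt , Γt
    where
    Γt : _ ∈ Γ 𝒟 t
    Γt with x∈p∪q⁻ γ-parent ⁅ v ⁆ x∈
    ... | inj₁ x∈γ = let (a , eat , x∈γat) = γ-parent⁻ x∈γ in γ-in⊆Γ 𝒟 eat x∈γat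
    ... | inj₂ x∈v = subst (_∈ Γ 𝒟 t) (sym (x∈⁅y⁆⇒x≡y v x∈v)) (β⊆Γ 𝒟 v∈βt)
  γ′⊆Γ {nothing} {nothing} ()

  root′-no-parent : ∀ z → edge′ z root′ ≡ false
  root′-no-parent z with t ≟ ρ
  root′-no-parent (just a) | yes t≡ρ = subst (λ u → E a u ≡ false) (sym t≡ρ) (root-no-parent T a)
  root′-no-parent nothing  | yes _   = refl
  root′-no-parent (just a) | no t≢ρ rewrite dec-false (ρ ≟ t) (t≢ρ ∘ sym) = root-no-parent T a
  root′-no-parent nothing  | no t≢ρ  = dec-false (ρ ≟ t) (t≢ρ ∘ sym)

  Reach′-root′ : ∀ z → Reach′ root′ z
  Reach′-root′ z with t ≟ ρ
  Reach′-root′ nothing  | yes _   = ε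
  Reach′-root′ (just b) | yes t≡ρ =
    edge′-new⁺ ◅ TReach⇒Reach′ (subst (λ u → TReach E u b) (sym t≡ρ) (all-reachable T b))
  Reach′-root′ (just b) | no _    = TReach⇒Reach′ (all-reachable T b)
  Reach′-root′ nothing  | no t≢ρ  = TReach⇒Reach′-new (t≢ρ ∘ sym) (all-reachable T t)

  root′-nonempty : ∃ λ x → x ∈ β′ root′
  root′-nonempty with t ≟ ρ
  ... | yes _  = v , x∈⁅x⁆ v
  ... | no t≢ρ =
    let (x , x∈βρ) = proj₂ (proj₂ partition) in
    x , x∈p∧x≢y⇒x∈p-y x∈βρ (λ { refl → t≢ρ (bag-unique v t ρ v∈βt x∈βρ) })

  parent′-unique : ∀ {z z′ w} → Edge′ z w → Edge′ z′ w → z ≡ z′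
  parent′-unique {just a}  {just a′} {nothing} e e′ = cong just (parent-unique T a a′ t e e′)
  parent′-unique {just a}  {just a′} {just b}  e e′ =
    cong just (parent-unique T a a′ b (proj₂ (edge′-old⁻ e)) (proj₂ (edge′-old⁻ e′)))
  parent′-unique {nothing} {nothing}           _ _  = refl
  parent′-unique {just _}  {nothing} {just b}  e e′ = ⊥-elim (proj₁ (edge′-old⁻ e) (edge′-new⁻ {b} e′))
  parent′-unique {nothing} {just _}  {just b}  e e′ = ⊥-elim (proj₁ (edge′-old⁻ e′) (edge′-new⁻ {b} e))
  parent′-unique {nothing} {just _}  {nothing} () _
  parent′-unique {just _}  {nothing} {nothing} _ ()

  β′-covers : ∀ x → ∃ λ w → x ∈ β′ w
  β′-covers x with x ≟ v
  ... | yes refl = nothing , x∈⁅x⁆ v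
  ... | no x≢v   = let (b , x∈) = proj₁ partition x in just b , x∈p∧x≢y⇒x∈p-y x∈ x≢v

  β′-unique : ∀ x w w′ → x ∈ β′ w → x ∈ β′ w′ → w ≡ w′
  β′-unique x (just a) (just b) x∈ x∈′ = cong just (bag-unique x a b (β′⊆β (just a) x∈) (β′⊆β (just b) x∈′))
  β′-unique x nothing  nothing  _  _   = refl
  β′-unique x (just a) nothing  x∈ x∈′ =
    v∈β′⇒new (just a) (subst (_∈ β′ (just a)) (x∈⁅y⁆⇒x≡y v x∈′) x∈)
  β′-unique x nothing  (just b) x∈ x∈′ =
    sym (v∈β′⇒new (just b) (subst (_∈ β′ (just b)) (x∈⁅y⁆⇒x≡y v x∈) x∈′))

  -- The same tree with nodes renumbered into Fin (suc m)

  edge″ : Fin (suc m) → Fin (suc m) → Bool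
  edge″ i j = edge′ (toMaybe i) (toMaybe j)

  TReach″⇒Reach′ : ∀ {i j} → TReach edge″ i j → Reach′ (toMaybe i) (toMaybe j)
  TReach″⇒Reach′ here       = ε
  TReach″⇒Reach′ (step e p) = e ◅ TReach″⇒Reach′ p

  Reach′⇒TReach″ : ∀ {z w} → Reach′ z w → TReach edge″ (fromMaybe z) (fromMaybe w)
  Reach′⇒TReach″ ε = here
  Reach′⇒TReach″ (_◅_ {z} {r} e p) =
    step (subst₂ Edge′ (sym (toMaybe-fromMaybe z)) (sym (toMaybe-fromMaybe r)) e) (Reach′⇒TReach″ p)

  tree′ : RootedTree (suc m)
  tree′ = record
    { edge           = edge″
    ; root           = fromMaybe root′
    ; root-no-parent = λ i → subst (λ w → edge′ (toMaybe i) w ≡ false)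
                                   (sym (toMaybe-fromMaybe root′)) (root′-no-parent (toMaybe i))
    ; parent-unique  = λ _ _ _ e e′ → toMaybe-injective (parent′-unique e e′)
    ; all-reachable  = λ i → subst (TReach edge″ (fromMaybe root′)) (fromMaybe-toMaybe i)
                                   (Reach′⇒TReach″ (Reach′-root′ (toMaybe i)))
    }

  𝒟′ : Decomp D (suc m)
  𝒟′ = record { tree = tree′ ; β = β′ ∘ toMaybe ; γ = λ i j → γ′ (toMaybe i) (toMaybe j) }

  ∈β′⇒∈β-𝒟′ : ∀ {x} w → x ∈ β′ w → x ∈ β 𝒟′ (fromMaybe w)
  ∈β′⇒∈β-𝒟′ {x} w = subst (λ w′ → x ∈ β′ w′) (sym (toMaybe-fromMaybe w))

  InSubtree-𝒟′ : ∀ i → InSubtree′ (toMaybe i) U.≐ InSubtree 𝒟′ i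
  InSubtree-𝒟′ i =
    (λ (w , p , x∈) → fromMaybe w ,
       subst (λ i′ → TReach edge″ i′ (fromMaybe w)) (fromMaybe-toMaybe i) (Reach′⇒TReach″ p) ,
       ∈β′⇒∈β-𝒟′ w x∈) ,
    (λ (j , p , x∈) → toMaybe j , TReach″⇒Reach′ p , x∈)

  partition′ : IsPartition 𝒟′
  partition′ =
    (λ x → let (w , x∈) = β′-covers x in fromMaybe w , ∈β′⇒∈β-𝒟′ w x∈) ,
    (λ x i j x∈ x∈′ → toMaybe-injective (β′-unique x _ _ x∈ x∈′)) ,
    (let (x , x∈) = root′-nonempty in x , ∈β′⇒∈β-𝒟′ root′ x∈)

  isUSC′ : IsUSCDTD 𝒟′
  isUSC′ = partition′ , λ i j e →
    UnionOfStrongComponents-resp (InSubtree-𝒟′ j) (Edge′-union (toMaybe i) (toMaybe j) e)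

  Γ′⊆Γ : ∀ i → Γ 𝒟′ i ⊆ Γ 𝒟 (origin (toMaybe i))
  Γ′⊆Γ i = Γ-least 𝒟′ (λ x∈ → β⊆Γ 𝒟 (β′⊆β (toMaybe i) x∈))
                      (λ s e x∈ → proj₂ (γ′⊆Γ {toMaybe s} {toMaybe i} e x∈))
                      (λ s e x∈ → proj₁ (γ′⊆Γ {toMaybe i} e x∈))

  width′ : ∀ {k} → WidthAtMost 𝒟 k → WidthAtMost 𝒟′ k
  width′ width i = ≤-trans (p⊆q⇒∣p∣≤∣q∣ (Γ′⊆Γ i)) (width _)

  ∣β′∣-old : ∀ r → r ≢ t → ∣ β 𝒟′ (inject₁ r) ∣ ≡ ∣ β 𝒟 r ∣
  ∣β′∣-old r r≢t = trans (cong (∣_∣ ∘ β′) (toMaybe-inject₁ r))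
                         (cong ∣_∣ (x∉p⇒p-x≡p (λ v∈βr → r≢t (bag-unique v r t v∈βr v∈βt))))

  ∣β′∣-t : ∣ β 𝒟′ (inject₁ t) ∣ ≡ ∣ β 𝒟 t ∣ ∸ 1
  ∣β′∣-t = trans (cong (∣_∣ ∘ β′) (toMaybe-inject₁ t)) (cong (_∸ 1) (x∈p⇒suc∣p-x∣≡∣p∣ v∈βt))

  ∣β′∣-new : ∣ β 𝒟′ (fromℕ m) ∣ ≡ 1
  ∣β′∣-new = trans (cong (∣_∣ ∘ β′) (toMaybe-fromℕ m)) (∣⁅x⁆∣≡1 v)

lemma7p3 : ∀ {n m k : ℕ} (D : Digraph n) (𝒟 : Decomp D m)
    → IsSCDTD 𝒟 → HasWidth 𝒟 k
    → (t : Fin m) → 2 ≤ ∣ β 𝒟 t ∣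
    → Σ (Decomp D (suc m)) λ 𝒟' →
        IsUSCDTD 𝒟' × WidthAtMost 𝒟' k
        × (∀ r → r ≢ t → ∣ β 𝒟' (inject₁ r) ∣ ≡ ∣ β 𝒟 r ∣)
        × ∣ β 𝒟' (inject₁ t) ∣ ≡ ∣ β 𝒟 t ∣ ∸ 1
        × ∣ β 𝒟' (fromℕ m) ∣ ≡ 1
lemma7p3 D 𝒟 isSC (width , _) t 2≤∣βt∣ =
  let (v , v∈βt) = 0<∣p∣⇒Nonempty (≤-trans (s≤s z≤n) 2≤∣βt∣)
      open Detach 𝒟 isSC t v v∈βt
  in 𝒟′ , isUSC′ , width′ width , ∣β′∣-old , ∣β′∣-t , ∣β′∣-new
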